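{- Let $\mathcal{A}1$ be an allotment of an LBDD instance $(S,D,\mathcal{CM},(c_i),(q_i))$ that induces no negative cost loop. Let $s_j\in S$ and let $d\in D$ be a demand unit assigned to $s_j$ in $\mathcal{A}1$. Form a new instance by replacing $d$ with a new demand unit $d_i\notin D$ whose costs $\mathcal{CM}(d_i,s_x)$, $1\le x\le k$, are arbitrary positive integers (all other data unchanged), and let $\mathcal{A}2$ be the allotment of the new instance that agrees with $\mathcal{A}1$ on $D\setminus\{d\}$ and assigns $d_i$ to $s_j$. Let $C_{min}$ be a loop of least cost among the loops induced by $\mathcal{A}2$ that pass through $s_j$. Then: (a) if the cost of $C_{min}$ is greater than or equal to zero, then $\mathcal{A}2$ does not induce any negative cost loop; (b) if the cost of $C_{min}$ is less than zero and $\mathcal{A}3$ is the allotment obtained from $\mathcal{A}2$ by removing $C_{min}$, then $\mathcal{A}3$ does not induce any negative cost loop.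
   Context: An instance of the Load Balanced Demand Distribution (LBDD) problem consists of: a finite set $S=\{s_1,\dots,s_k\}$ of service centers ($k\ge 2$); a finite set $D$ of demand units; a cost matrix $\mathcal{CM}$ giving a positive integer $\mathcal{CM}(d,s)$ for every pair $(d,s)\in D\times S$; for each $s_i$ a positive integer capacity $c_i$; and for each $s_i$ a penalty function $q_i$ on the positive integers, where $q_i(m)$ is the extra cost incurred by the $m$-th demand unit assigned to $s_i$: $q_i(m)=0$ for $m\le c_i$, and for $m>c_i$ the values $q_i(m)$ are positive and monotonically increasing in $m$ (convention $q_i(0)=0$). An allotment $\mathcal{A}$ assigns every demand unit to exactly one service center. The occupancy $o_i=o_i(\mathcal{A})$ is the number of demand units assigned to $s_i$. The allotment subspace multigraph $\Gamma(\mathcal{A})$ has vertex set $S$ and, for each demand unit $dn$ assigned to $s_i$ and each $s_j\neq s_i$, a directed transfer edge $(s_i,s_j,dn)$ of cost $\mathcal{CM}(dn,s_j)-\mathcal{CM}(dn,s_i)$. The penalty transfer edge from $s_x$ to $s_y$ ($x\ne y$) has weight $q_x(o_x+1)-q_y(o_y)$. A loop induced by $\mathcal{A}$ from $s_a$ to $s_b$ ($s_a\neq s_b$) consists of a directed path $P$ in $\Gamma(\mathcal{A})$ from $s_a$ to $s_b$ with pairwise distinct vertices, closed either (i) by a transfer edge of $\Gamma(\mathcal{A})$ from $s_b$ to $s_a$, the loop's cost being the sum of the costs of all its transfer edges; or (ii) by the penalty transfer edge from $s_b$ to $s_a$, the loop's cost being the sum of the costs of the edges of $P$ plus $q_b(o_b+1)-q_a(o_a)$.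 The loop passes through every vertex of $P$. A loop is a negative cost loop if its cost is less than zero. Removing a loop from $\mathcal{A}$ means: for every transfer edge $(s_x,s_y,dn)$ of the loop, reassign $dn$ to $s_y$ (all other assignments unchanged). -}

module Defs where

open import Data.Nat as ℕ using (ℕ; zero; suc; _≤_; _<_)
open import Data.Integer as ℤ using (ℤ; +_; _-_; 0ℤ)
open import Data.Fin using (Fin; _≟_)
open import Data.List using (List; []; _∷_; _++_; foldr; filter; length; map)
open import Data.List.Relation.Unary.Unique.Propositional using (Unique)
open import Data.List.Membership.Propositional using (_∈_)
import Data.Empty
open import Data.Product using (_×_; _,_)
open import Data.Vec.Functional using (Vector)
open import Data.List using (allFin) public
open import Relation.Binary.PropositionalEquality using (_≡_)
open import Relation.Nullary using (does)
open import Data.Bool using (if_then_else_)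

-- Service centers are Fin k, demand units are Fin n.
-- An allotment assigns each demand unit a service center.
Allotment : ℕ → ℕ → Set
Allotment n k = Fin n → Fin k

IsPenalty : ∀ {k} → (Fin k → ℕ) → (Fin k → ℕ → ℕ) → Set
IsPenalty {k} c q = ∀ (i : Fin k) →
  (∀ m → m ≤ c i → q i m ≡ 0)
  × (∀ m → c i < m → 0 < q i m)
  × (∀ m m′ → c i < m → m ≤ m′ → q i m ≤ q i m′)

occ : ∀ {n k} → Allotment n k → Fin k → ℕ
occ {n} A i = length (filter (λ d → A d ≟ i) (allFin n))

sumℤ : List ℤ → ℤ
sumℤ = foldr ℤ._+_ 0ℤ

module _ {n k : ℕ} (A : Allotment n k) where

  -- Directed path in Γ(A) from x to y made of transfer edges (s_u, s_v, dn)
  -- with dn assigned to s_u.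
  data Path : Fin k → Fin k → Set where
    step : ∀ {x} (dn : Fin n) (y : Fin k) → A dn ≡ x → Path x y
    cons : ∀ {x z} (dn : Fin n) (y : Fin k) → A dn ≡ x → Path y z → Path x z

  vertices : ∀ {x y} → Path x y → List (Fin k)
  vertices (step {x} _ y _) = x ∷ y ∷ []
  vertices (cons {x} _ _ _ p) = x ∷ vertices p

  pathEdges : ∀ {x y} → Path x y → List (Fin n × Fin k)
  pathEdges (step dn y _) = (dn , y) ∷ []
  pathEdges (cons dn y _ p) = (dn , y) ∷ pathEdges p

  data Closing (a b : Fin k) : Set where
    viaTransfer : (dn : Fin n) → A dn ≡ b → Closing a b   -- transfer edge (s_b, s_a, dn)
    viaPenalty  : Closing a b                             -- penalty transfer edge s_b → s_a

  record Loop : Set where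
    constructor mkLoop
    field
      a b      : Fin k
      a≢b      : a ≡ b → Data.Empty.⊥
      path     : Path a b
      distinct : Unique (vertices path)
      closing  : Closing a b

  open Loop public

  loopEdges : Loop → List (Fin n × Fin k)
  loopEdges L with closing L
  ... | viaTransfer dn _ = pathEdges (path L) ++ ((dn , a L) ∷ [])
  ... | viaPenalty       = pathEdges (path L)

  passesThrough : Fin k → Loop → Set
  passesThrough s L = s ∈ vertices (path L)

  loopCost : (Fin n → Fin k → ℕ) → (Fin k → ℕ → ℕ) → Loop → ℤ
  loopCost CM q L with closing L
  ... | viaTransfer _ _ = sumℤ (map edgeCost (loopEdges L))
    where edgeCost : Fin n × Fin k → ℤ
          edgeCost (dn , y) = + CM dn y - + CM dn (A dn)
  ... | viaPenalty =
        sumℤ (map edgeCost (loopEdges L))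
        ℤ.+ (+ q (b L) (suc (occ A (b L))) - + q (a L) (occ A (a L)))
    where edgeCost : Fin n × Fin k → ℤ
          edgeCost (dn , y) = + CM dn y - + CM dn (A dn)

  removeLoop : Loop → Allotment n k
  removeLoop L = foldr reassign A (loopEdges L)
    where reassign : Fin n × Fin k → Allotment n k → Allotment n k
          reassign (dn , y) B d = if does (d ≟ dn) then y else B d

NoNegLoop : ∀ {n k} → (Fin n → Fin k → ℕ) → (Fin k → ℕ → ℕ) → Allotment n k → Set
NoNegLoop CM q A = ∀ (L : Loop A) → 0ℤ ℤ.≤ loopCost A CM q L

replaceRow : ∀ {n k} → (Fin n → Fin k → ℕ) → Fin n → (Fin k → ℕ) → Fin n → Fin k → ℕ
replaceRow CM d new d′ x = if does (d′ ≟ d) then new x else CM d′ x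

-- Give an allotment X the total cost Σ_d CM(d, X d) + Σ_i (q_i(1) + ⋯ + q_i(o_i)). Removing a
-- loop changes it by exactly the cost of the loop. Conversely, if B ≠ A, tracing the units of B
-- backwards from a center B overloads (or from any unit B moves) yields a loop of A that B carries
-- out and that costs at most what B pays for it; undoing that loop brings B closer to A. By
-- induction, if every loop of A costs at least m ≤ 0 and every loop not moving d costs at least 0,
-- then cost A + m ≤ cost B, and cost A ≤ cost B whenever B keeps d where A has it.
-- With m = 0 this makes A1 optimal, hence also A2, which equals A1 as a function, under the old
-- cost matrix. A loop of A2 that does not move d never sees the replaced row, so it costs at least
-- 0, and a loop that moves d passes through s_j and costs at least C_min: this is (a). For (b), A2
-- satisfies the bound with m = cost C_min, so removing C_min gives an allotment of total cost
-- cost A2 + m, which is optimal and therefore induces no negative loop.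

module Submission where

open import Defs
open import Data.Nat as ℕ using (ℕ; zero; suc; _≤_; _<_)
import Data.Nat.Properties as ℕP
open import Data.Integer as ℤ using (ℤ; +_; _+_; _-_; -_; 0ℤ)
import Data.Integer.Properties as ℤP
open import Data.Integer.Tactic.RingSolver using (solve-∀)
open import Data.Fin using (Fin; zero; suc)
open import Data.Fin.Properties using (_≟_; any?; pigeonhole; <⇒≢)
open import Data.Vec.Functional using (updateAt)
open import Data.Vec.Functional.Properties using (updateAt-updates; updateAt-minimal)
open import Data.List using (List; []; _∷_; _++_; map; foldr; length; filter; tabulate; lookup)
open import Data.List.Properties using (map-cong-local; map-++; map-∘)
open import Data.List.Membership.Propositional using (_∈_; _∉_)
open import Data.List.Membership.Propositional.Properties using (∈-map⁺; ∈-map⁻; ∈-++⁻; ∈-++⁺ˡ; ∈-lookup)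
open import Data.List.Relation.Unary.Any using (here; there)
import Data.List.Relation.Unary.Any as Any
import Data.List.Relation.Unary.All as All
open import Data.List.Relation.Unary.All.Properties using (¬Any⇒All¬)
open import Data.List.Relation.Unary.AllPairs using ([]; _∷_)
open import Data.List.Relation.Unary.Unique.Propositional using (Unique)
import Data.List.Relation.Unary.Unique.Propositional.Properties as Unique
open import Data.Product using (_×_; _,_; proj₁; proj₂; ∃)
open import Data.Sum using (_⊎_; inj₁; inj₂; [_,_]′; map₁)
open import Data.Bool using (true; false; if_then_else_)
open import Data.Empty using (⊥-elim)
open import Data.Unit using (⊤; tt)
open import Function using (_∘_; id; const; flip)
open import Relation.Nullary using (¬_; Dec; yes; no; does)
open import Relation.Nullary.Decidable using (dec-true; dec-false; decidable-stable; toSum; _×-dec_; ¬?)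
open import Relation.Binary.PropositionalEquality
open import Algebra.Properties.CommutativeMonoid.Sum ℤP.+-0-commutativeMonoid
  using (sum; sum-syntax; sum-cong-≗; sum-replicate-zero; ∑-distrib-+; ∑-comm)

i-j≡k⇒i≡j+k : ∀ i j {k} → i - j ≡ k → i ≡ j + k
i-j≡k⇒i≡j+k i j refl = lemma i j
  where lemma : ∀ i j → i ≡ j + (i - j)
        lemma = solve-∀

i-j≡k⇒j-i≡-k : ∀ i j {k} → i - j ≡ k → j - i ≡ - k
i-j≡k⇒j-i≡-k i j refl = lemma i j
  where lemma : ∀ i j → j - i ≡ - (i - j)
        lemma = solve-∀

i≤i+j⇒0≤j : ∀ i j → i ℤ.≤ i + j → 0ℤ ℤ.≤ j
i≤i+j⇒0≤j i j i≤i+j = subst₂ ℤ._≤_ (ℤP.+-inverseˡ i) (cancel i j) (ℤP.+-monoʳ-≤ (- i) i≤i+j)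
  where cancel : ∀ i j → - i + (i + j) ≡ j
        cancel = solve-∀

i+j≤k⇐j≤k-i : ∀ i j k → j ℤ.≤ k - i → i + j ℤ.≤ k
i+j≤k⇐j≤k-i i j k j≤k-i = ℤP.≤-trans (ℤP.+-monoʳ-≤ i j≤k-i) (ℤP.≤-reflexive (cancel i k))
  where cancel : ∀ i k → i + (k - i) ≡ k
        cancel = solve-∀

+m-+n≡0⇒m≡n : ∀ m n → + m - + n ≡ 0ℤ → m ≡ n
+m-+n≡0⇒m≡n m n e = ℤP.+-injective (trans (i-j≡k⇒i≡j+k (+ m) (+ n) e) (ℤP.+-identityʳ (+ n)))

sum-neg : ∀ {m} (f : Fin m → ℤ) → ∑[ x < m ] (- f x) ≡ - sum f
sum-neg {zero}  f = refl
sum-neg {suc m} f = trans (cong (_+_ (- f zero)) (sum-neg (f ∘ suc)))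
                          (sym (ℤP.neg-distrib-+ (f zero) (sum (f ∘ suc))))

∑-distrib-- : ∀ {m} (f g : Fin m → ℤ) → ∑[ x < m ] (f x - g x) ≡ sum f - sum g
∑-distrib-- f g = trans (∑-distrib-+ f (-_ ∘ g)) (cong (_+_ (sum f)) (sum-neg g))

sum-zero : ∀ {m} {f : Fin m → ℤ} → (∀ x → f x ≡ 0ℤ) → sum f ≡ 0ℤ
sum-zero {m} f≗0 = trans (sum-cong-≗ f≗0) (sum-replicate-zero m)

sum-mono-≤ : ∀ {m} {f g : Fin m → ℤ} → (∀ x → f x ℤ.≤ g x) → sum f ℤ.≤ sum g
sum-mono-≤ {zero}  f≤g = ℤP.≤-refl
sum-mono-≤ {suc m} f≤g = ℤP.+-mono-≤ (f≤g zero) (sum-mono-≤ (f≤g ∘ suc))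

sum-mono-< : ∀ {m} {f g : Fin m → ℤ} → (∀ x → f x ℤ.≤ g x) → ∀ u → f u ℤ.< g u → sum f ℤ.< sum g
sum-mono-< f≤g zero    fu<gu = ℤP.+-mono-<-≤ fu<gu (sum-mono-≤ (f≤g ∘ suc))
sum-mono-< f≤g (suc u) fu<gu = ℤP.+-mono-≤-< (f≤g zero) (sum-mono-< (f≤g ∘ suc) u fu<gu)

sum-extract : ∀ {m} (h : Fin m → ℤ) u → sum h ≡ h u + sum (updateAt h u (const 0ℤ))
sum-extract h zero    = cong (_+_ (h zero)) (sym (ℤP.+-identityˡ _))
sum-extract h (suc u) = trans (cong (_+_ (h zero)) (sum-extract (h ∘ suc) u))
                              (swap (h zero) (h (suc u)) _)
  where swap : ∀ a b c → a + (b + c) ≡ b + (a + c)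
        swap = solve-∀

sum-support : ∀ {m} (U : List (Fin m)) → Unique U → (h : Fin m → ℤ) →
              (∀ x → x ∉ U → h x ≡ 0ℤ) → sum h ≡ sumℤ (map h U)
sum-support []      _            h h≡0 = sum-zero (λ x → h≡0 x λ ())
sum-support (u ∷ U) (u∉U ∷ !U) h h≡0 = begin
  sum h                  ≡⟨ sum-extract h u ⟩
  h u + sum h′           ≡⟨ cong (_+_ (h u)) (sum-support U !U h′ h′≡0) ⟩
  h u + sumℤ (map h′ U)  ≡⟨ cong (λ t → h u + sumℤ t) (map-cong-local (All.map h′≡h u∉U)) ⟩
  h u + sumℤ (map h U)   ∎
  where
  open ≡-Reasoning
  h′ = updateAt h u (const 0ℤ)
  h′≡h : ∀ {x} → u ≢ x → h′ x ≡ h x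
  h′≡h u≢x = updateAt-minimal _ u h (u≢x ∘ sym)
  h′≡0 : ∀ x → x ∉ U → h′ x ≡ 0ℤ
  h′≡0 x x∉U with x ≟ u
  ... | yes refl = updateAt-updates u h
  ... | no x≢u   = trans (h′≡h (x≢u ∘ sym))
                         (h≡0 x λ { (here x≡u) → x≢u x≡u ; (there x∈U) → x∉U x∈U })

sumℤ-++ : (xs ys : List ℤ) → sumℤ (xs ++ ys) ≡ sumℤ xs + sumℤ ys
sumℤ-++ []       ys = sym (ℤP.+-identityˡ _)
sumℤ-++ (x ∷ xs) ys = trans (cong (_+_ x) (sumℤ-++ xs ys)) (sym (ℤP.+-assoc x (sumℤ xs) (sumℤ ys)))

δ : ∀ {k} → Fin k → Fin k → ℤ
δ x i = if does (x ≟ i) then + 1 else 0ℤ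

δ-refl : ∀ {k} (x : Fin k) → δ x x ≡ + 1
δ-refl x = cong (if_then + 1 else 0ℤ) (dec-true (x ≟ x) refl)

δ-≢ : ∀ {k} {x i : Fin k} → x ≢ i → δ x i ≡ 0ℤ
δ-≢ {x = x} {i} x≢i = cong (if_then + 1 else 0ℤ) (dec-false (x ≟ i) x≢i)

δ-nonneg : ∀ {k} (x i : Fin k) → 0ℤ ℤ.≤ δ x i
δ-nonneg x i with does (x ≟ i)
... | true  = ℤ.+≤+ ℕ.z≤n
... | false = ℤ.+≤+ ℕ.z≤n

sum-δ : ∀ {k} (x : Fin k) → ∑[ i < k ] δ x i ≡ + 1
sum-δ x = begin
  ∑[ i < _ ] δ x i  ≡⟨ sum-support (x ∷ []) (All.[] ∷ []) (δ x) (λ i i∉ → δ-≢ (i∉ ∘ here ∘ sym)) ⟩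
  δ x x + 0ℤ        ≡⟨ ℤP.+-identityʳ (δ x x) ⟩
  δ x x             ≡⟨ δ-refl x ⟩
  + 1               ∎
  where open ≡-Reasoning

length-filter-tabulate : ∀ {m p} {B : Set} {P : B → Set p} (P? : ∀ b → Dec (P b)) (g : Fin m → B) →
  + length (filter P? (tabulate g)) ≡ ∑[ x < m ] (if does (P? (g x)) then + 1 else 0ℤ)
length-filter-tabulate {zero}  P? g = refl
length-filter-tabulate {suc m} P? g with does (P? (g zero))
... | true  = trans (ℤP.pos-+ 1 _) (cong (_+_ (+ 1)) (length-filter-tabulate P? (g ∘ suc)))
... | false = trans (length-filter-tabulate P? (g ∘ suc)) (sym (ℤP.+-identityˡ _))

occ-δ : ∀ {n k} (X : Allotment n k) i → + occ X i ≡ ∑[ dn < n ] δ (X dn) i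
occ-δ X i = length-filter-tabulate (λ d → X d ≟ i) id

occ-cong : ∀ {n k} {X Y : Allotment n k} → (∀ dn → X dn ≡ Y dn) → ∀ i → occ X i ≡ occ Y i
occ-cong {X = X} {Y} X≗Y i = ℤP.+-injective (begin
  + occ X i              ≡⟨ occ-δ X i ⟩
  ∑[ dn < _ ] δ (X dn) i ≡⟨ sum-cong-≗ (λ dn → cong (λ x → δ x i) (X≗Y dn)) ⟩
  ∑[ dn < _ ] δ (Y dn) i ≡⟨ occ-δ Y i ⟨
  + occ Y i              ∎)
  where open ≡-Reasoning

sum-occ : ∀ {n k} (X : Allotment n k) → ∑[ i < k ] (+ occ X i) ≡ + n
sum-occ {n} {k} X = begin
  ∑[ i < k ] (+ occ X i)               ≡⟨ sum-cong-≗ (occ-δ X) ⟩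
  ∑[ i < k ] ∑[ dn < n ] δ (X dn) i   ≡⟨ ∑-comm (λ i dn → δ (X dn) i) ⟩
  ∑[ dn < n ] ∑[ i < k ] δ (X dn) i   ≡⟨ sum-cong-≗ (sum-δ ∘ X) ⟩
  ∑[ dn < n ] (+ 1)                    ≡⟨ sum-one n ⟩
  + n                                 ∎
  where
  open ≡-Reasoning
  sum-one : ∀ m → ∑[ x < m ] (+ 1) ≡ + m
  sum-one zero    = refl
  sum-one (suc m) = trans (cong (_+_ (+ 1)) (sum-one m)) (sym (ℤP.pos-+ 1 m))

mismatch : ∀ {k} → Fin k → Fin k → ℤ
mismatch x y = if does (x ≟ y) then 0ℤ else + 1

mismatch-≡ : ∀ {k} {x y : Fin k} → x ≡ y → mismatch x y ≡ 0ℤ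
mismatch-≡ {x = x} {y} x≡y = cong (if_then 0ℤ else + 1) (dec-true (x ≟ y) x≡y)

mismatch-≢ : ∀ {k} {x y : Fin k} → x ≢ y → mismatch x y ≡ + 1
mismatch-≢ {x = x} {y} x≢y = cong (if_then 0ℤ else + 1) (dec-false (x ≟ y) x≢y)

mismatch-nonneg : ∀ {k} (x y : Fin k) → 0ℤ ℤ.≤ mismatch x y
mismatch-nonneg x y with does (x ≟ y)
... | true  = ℤP.≤-refl
... | false = ℤ.+≤+ ℕ.z≤n

-- Paths and loops

Unique-lookup-injective : ∀ {X : Set} {xs : List X} → Unique xs →
                          ∀ {i j} → lookup xs i ≡ lookup xs j → i ≡ j
Unique-lookup-injective (_ ∷ _)   {zero}  {zero}  _  = refl
Unique-lookup-injective (x∉ ∷ _)  {zero}  {suc j} eq = ⊥-elim (All.lookup x∉ (∈-lookup j) eq)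
Unique-lookup-injective (x∉ ∷ _)  {suc i} {zero}  eq = ⊥-elim (All.lookup x∉ (∈-lookup i) (sym eq))
Unique-lookup-injective (_ ∷ !xs) {suc i} {suc j} eq = cong suc (Unique-lookup-injective !xs eq)

Unique-length≤ : ∀ {k} {xs : List (Fin k)} → Unique xs → length xs ≤ k
Unique-length≤ {xs = xs} !xs = ℕP.≮⇒≥ λ k<len →
  let i , j , i<j , same = pigeonhole k<len (lookup xs) in <⇒≢ i<j (Unique-lookup-injective !xs same)

units : ∀ {n k} → List (Fin n × Fin k) → List (Fin n)
units = map proj₁

module _ {n k : ℕ} {A : Allotment n k} where

  head∈vertices : ∀ {x y} (p : Path A x y) → x ∈ vertices A p
  head∈vertices (step _ _ _)   = here refl
  head∈vertices (cons _ _ _ _) = here refl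

  last∈vertices : ∀ {x y} (p : Path A x y) → y ∈ vertices A p
  last∈vertices (step _ _ _)   = there (here refl)
  last∈vertices (cons _ _ _ p) = there (last∈vertices p)

  source∈vertices : ∀ {x y} (p : Path A x y) {e} → e ∈ pathEdges A p → A (proj₁ e) ∈ vertices A p
  source∈vertices (step _ _ refl)   (here refl) = here refl
  source∈vertices (cons _ _ refl _) (here refl) = here refl
  source∈vertices (cons _ _ _ p)    (there e∈)  = there (source∈vertices p e∈)

  source≢last : ∀ {x y} (p : Path A x y) → Unique (vertices A p) →
                ∀ {e} → e ∈ pathEdges A p → A (proj₁ e) ≢ y
  source≢last (step _ _ refl)   (x∉ ∷ _)  (here refl) = All.head x∉
  source≢last (cons _ _ refl p) (x∉ ∷ _)  (here refl) = All.lookup x∉ (last∈vertices p)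
  source≢last (cons _ _ _ p)    (_ ∷ !p) (there e∈)  = source≢last p !p e∈

  target≢source : ∀ {x y} (p : Path A x y) → Unique (vertices A p) →
                  ∀ {e} → e ∈ pathEdges A p → proj₂ e ≢ A (proj₁ e)
  target≢source (step _ _ refl)   (x∉ ∷ _)  (here refl) = All.head x∉ ∘ sym
  target≢source (cons _ _ refl p) (x∉ ∷ _)  (here refl) = All.lookup x∉ (head∈vertices p) ∘ sym
  target≢source (cons _ _ _ p)    (_ ∷ !p) (there e∈)  = target≢source p !p e∈

  pathUnits-unique : ∀ {x y} (p : Path A x y) → Unique (vertices A p) → Unique (units (pathEdges A p))
  pathUnits-unique (step _ _ _)       _          = All.[] ∷ []
  pathUnits-unique (cons dn _ refl p) (x∉ ∷ !p) = ¬Any⇒All¬ _ dn∉ ∷ pathUnits-unique p !p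
    where
    dn∉ : dn ∉ units (pathEdges A p)
    dn∉ dn∈ with ∈-map⁻ proj₁ dn∈
    ... | _ , e∈ , refl = All.lookup x∉ (source∈vertices p e∈) refl

  firstEdge : ∀ {v b} (p : Path A v b) → ∃ λ e → e ∈ pathEdges A p × A (proj₁ e) ≡ v
  firstEdge (step dn y eq)   = (dn , y) , here refl , eq
  firstEdge (cons dn y eq _) = (dn , y) , here refl , eq

  prefix : ∀ {v b w} (p : Path A v b) → Unique (vertices A p) → w ∈ vertices A p → w ≢ v →
           ∃ λ (q : Path A v w) → Unique (vertices A q)
                                 × (∀ {u} → u ∈ vertices A q → u ∈ vertices A p)
                                 × (∀ {e} → e ∈ pathEdges A q → e ∈ pathEdges A p)
  prefix (step _ _ _)    _  (here refl)         w≢v = ⊥-elim (w≢v refl)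
  prefix (step dn y eq)  !p (there (here refl)) _   = step dn y eq , !p , id , id
  prefix (cons _ _ _ _)  _  (here refl)         w≢v = ⊥-elim (w≢v refl)
  prefix {w = w} (cons dn y eq p) (v∉ ∷ !p) (there w∈) _ with w ≟ y
  ... | yes refl = step dn w eq , (All.lookup v∉ (head∈vertices p) All.∷ All.[]) ∷ All.[] ∷ []
                 , (λ { (here refl) → here refl ; (there (here refl)) → there (head∈vertices p) })
                 , λ { (here refl) → here refl }
  ... | no w≢y with prefix p !p w∈ w≢y
  ...   | q , !q , V⊆ , E⊆ = cons dn y eq q , All.tabulate (All.lookup v∉ ∘ V⊆) ∷ !q
                           , (λ { (here refl) → here refl ; (there u∈) → there (V⊆ u∈) })
                           , λ { (here refl) → here refl ; (there e∈) → there (E⊆ e∈) }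

  movedUnits : Loop A → List (Fin n)
  movedUnits L = units (loopEdges A L)

  loop-source∈vertices : (L : Loop A) → ∀ {e} → e ∈ loopEdges A L → A (proj₁ e) ∈ vertices A (path L)
  loop-source∈vertices (mkLoop _ _ _ p _ (viaTransfer _ refl)) e∈ with ∈-++⁻ (pathEdges A p) e∈
  ... | inj₁ e∈p         = source∈vertices p e∈p
  ... | inj₂ (here refl) = last∈vertices p
  loop-source∈vertices (mkLoop _ _ _ p _ viaPenalty) e∈ = source∈vertices p e∈

  loop-target≢source : (L : Loop A) → ∀ {e} → e ∈ loopEdges A L → proj₂ e ≢ A (proj₁ e)
  loop-target≢source (mkLoop _ _ a≢b p !p (viaTransfer _ refl)) e∈ with ∈-++⁻ (pathEdges A p) e∈
  ... | inj₁ e∈p         = target≢source p !p e∈p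
  ... | inj₂ (here refl) = a≢b
  loop-target≢source (mkLoop _ _ _ p !p viaPenalty) e∈ = target≢source p !p e∈

  loop-firstEdge : (L : Loop A) → ∃ λ e → e ∈ loopEdges A L
  loop-firstEdge (mkLoop _ _ _ p _ (viaTransfer _ _)) = _ , ∈-++⁺ˡ (proj₁ (proj₂ (firstEdge p)))
  loop-firstEdge (mkLoop _ _ _ p _ viaPenalty)        = _ , proj₁ (proj₂ (firstEdge p))

  moved-passesThrough : (L : Loop A) → ∀ {dn} → dn ∈ movedUnits L → passesThrough A (A dn) L
  moved-passesThrough L dn∈ with ∈-map⁻ proj₁ dn∈
  ... | _ , e∈ , refl = loop-source∈vertices L e∈

  passesThrough-or-unmoved : (L : Loop A) → ∀ dn → passesThrough A (A dn) L ⊎ dn ∉ movedUnits L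
  passesThrough-or-unmoved L dn with Any.any? (A dn ≟_) (vertices A (path L))
  ... | yes through = inj₁ through
  ... | no ¬through = inj₂ (¬through ∘ moved-passesThrough L)

  movedUnits-unique : (L : Loop A) → Unique (movedUnits L)
  movedUnits-unique (mkLoop a _ _ p !p (viaTransfer dn refl)) =
    subst Unique (sym (map-++ proj₁ (pathEdges A p) ((dn , a) ∷ [])))
      (Unique.++⁺ (pathUnits-unique p !p) (All.[] ∷ []) disjoint)
    where
    disjoint : ∀ {u} → ¬ (u ∈ units (pathEdges A p) × u ∈ dn ∷ [])
    disjoint (u∈ , here refl) with ∈-map⁻ proj₁ u∈
    ... | _ , e∈ , refl = source≢last p !p e∈ refl
  movedUnits-unique (mkLoop _ _ _ p !p viaPenalty) = pathUnits-unique p !p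

reassign : ∀ {n k} → Fin n × Fin k → Allotment n k → Allotment n k
reassign (dn , y) X d = if does (d ≟ dn) then y else X d

reassignAll-unmoved : ∀ {n k} (E : List (Fin n × Fin k)) (X : Allotment n k) dn →
                      dn ∉ units E → foldr reassign X E dn ≡ X dn
reassignAll-unmoved []              X dn _   = refl
reassignAll-unmoved ((dn′ , y) ∷ E) X dn dn∉ =
  trans (cong (if_then y else _) (dec-false (dn ≟ dn′) (dn∉ ∘ here)))
        (reassignAll-unmoved E X dn (dn∉ ∘ there))

reassignAll-moved : ∀ {n k} (E : List (Fin n × Fin k)) (X : Allotment n k) → Unique (units E) →
                    ∀ {e} → e ∈ E → foldr reassign X E (proj₁ e) ≡ proj₂ e
reassignAll-moved ((dn , y) ∷ E) X _          (here refl) =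
  cong (if_then y else foldr reassign X E dn) (dec-true (dn ≟ dn) refl)
reassignAll-moved ((dn , y) ∷ E) X (dn∉ ∷ !E) (there e∈)  =
  trans (cong (if_then y else _) (dec-false (_ ≟ dn) (All.lookup dn∉ (∈-map⁺ proj₁ e∈) ∘ sym)))
        (reassignAll-moved E X !E e∈)

module _ {n k : ℕ} {A : Allotment n k} (L : Loop A) where

  removeLoop-unmoved : ∀ dn → dn ∉ movedUnits L → removeLoop A L dn ≡ A dn
  removeLoop-unmoved = reassignAll-unmoved (loopEdges A L) A

  removeLoop-moved : ∀ {e} → e ∈ loopEdges A L → removeLoop A L (proj₁ e) ≡ proj₂ e
  removeLoop-moved = reassignAll-moved (loopEdges A L) A (movedUnits-unique L)

-- Occupancy and cost changes along a loop

record Transfers {n k} {A : Allotment n k} (L : Loop A) (X Y : Allotment n k) : Set where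
  field
    moved   : ∀ {e} → e ∈ loopEdges A L → Y (proj₁ e) ≡ proj₂ e
    source  : ∀ {e} → e ∈ loopEdges A L → X (proj₁ e) ≡ A (proj₁ e)
    unmoved : ∀ dn → dn ∉ movedUnits L → Y dn ≡ X dn

removeLoop-transfers : ∀ {n k} {A : Allotment n k} (L : Loop A) → Transfers L A (removeLoop A L)
removeLoop-transfers L = record
  { moved = removeLoop-moved L ; source = λ _ → refl ; unmoved = removeLoop-unmoved L }

moveChange : ∀ {n k} → Allotment n k → (Fin n → Fin k → ℤ) → Fin n × Fin k → ℤ
moveChange A f (dn , y) = f dn y - f dn (A dn)

closingOccChange : ∀ {n k} {A : Allotment n k} {a b} → Closing A a b → Fin k → ℤ
closingOccChange (viaTransfer _ _)     i = 0ℤ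
closingOccChange {a = a} {b} viaPenalty i = δ b i - δ a i

module _ {n k : ℕ} {A : Allotment n k} (i : Fin k) where

  occChange : Fin n × Fin k → ℤ
  occChange = moveChange A (λ _ x → δ x i)

  path-occChange : ∀ {x y} (p : Path A x y) → sumℤ (map occChange (pathEdges A p)) ≡ δ y i - δ x i
  path-occChange (step _ _ refl) = ℤP.+-identityʳ _
  path-occChange {x} {z} (cons _ y refl p) =
    trans (cong (_+_ (δ y i - δ x i)) (path-occChange p)) (telescope (δ y i) (δ x i) (δ z i))
    where telescope : ∀ u v w → (u - v) + (w - u) ≡ w - v
          telescope = solve-∀

  loop-occChange : (L : Loop A) → sumℤ (map occChange (loopEdges A L)) ≡ closingOccChange (closing L) i
  loop-occChange (mkLoop a b _ p _ (viaTransfer dn refl)) = begin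
    sumℤ (map occChange (pathEdges A p ++ (dn , a) ∷ []))
      ≡⟨ cong sumℤ (map-++ occChange (pathEdges A p) _) ⟩
    sumℤ (map occChange (pathEdges A p) ++ occChange (dn , a) ∷ [])
      ≡⟨ sumℤ-++ (map occChange (pathEdges A p)) _ ⟩
    sumℤ (map occChange (pathEdges A p)) + (δ a i - δ b i + 0ℤ)
      ≡⟨ cong (_+ (δ a i - δ b i + 0ℤ)) (path-occChange p) ⟩
    (δ b i - δ a i) + (δ a i - δ b i + 0ℤ)
      ≡⟨ cancel (δ a i) (δ b i) ⟩
    0ℤ ∎
    where open ≡-Reasoning
          cancel : ∀ u v → (v - u) + (u - v + 0ℤ) ≡ 0ℤ
          cancel = solve-∀
  loop-occChange (mkLoop _ _ _ p _ viaPenalty) = path-occChange p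

module _ {n k : ℕ} {A : Allotment n k} {L : Loop A} {X Y : Allotment n k} (T : Transfers L X Y) where
  open Transfers T

  transfers-sum : (f : Fin n → Fin k → ℤ) →
    ∑[ dn < n ] (f dn (Y dn) - f dn (X dn)) ≡ sumℤ (map (moveChange A f) (loopEdges A L))
  transfers-sum f = begin
    sum h                                         ≡⟨ sum-support (movedUnits L) (movedUnits-unique L) h h≡0 ⟩
    sumℤ (map h (units (loopEdges A L)))          ≡⟨ cong sumℤ (map-∘ (loopEdges A L)) ⟨
    sumℤ (map (h ∘ proj₁) (loopEdges A L))        ≡⟨ cong sumℤ (map-cong-local (All.tabulate h≡change)) ⟩
    sumℤ (map (moveChange A f) (loopEdges A L))   ∎
    where
    open ≡-Reasoning
    h : Fin n → ℤ
    h dn = f dn (Y dn) - f dn (X dn)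
    h≡0 : ∀ dn → dn ∉ movedUnits L → h dn ≡ 0ℤ
    h≡0 dn dn∉ = trans (cong (λ y → f dn y - f dn (X dn)) (unmoved dn dn∉)) (ℤP.+-inverseʳ (f dn (X dn)))
    h≡change : ∀ {e} → e ∈ loopEdges A L → h (proj₁ e) ≡ moveChange A f e
    h≡change e∈ = cong₂ (λ y x → f _ y - f _ x) (moved e∈) (source e∈)

  transfers-occ : ∀ i → + occ Y i - + occ X i ≡ closingOccChange (closing L) i
  transfers-occ i = begin
    + occ Y i - + occ X i
      ≡⟨ cong₂ _-_ (occ-δ Y i) (occ-δ X i) ⟩
    ∑[ dn < n ] δ (Y dn) i - ∑[ dn < n ] δ (X dn) i
      ≡⟨ ∑-distrib-- (λ dn → δ (Y dn) i) (λ dn → δ (X dn) i) ⟨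
    ∑[ dn < n ] (δ (Y dn) i - δ (X dn) i)
      ≡⟨ transfers-sum (λ _ x → δ x i) ⟩
    sumℤ (map (occChange {A = A} i) (loopEdges A L))
      ≡⟨ loop-occChange i L ⟩
    closingOccChange (closing L) i ∎
    where open ≡-Reasoning

module _ {k} (o o′ : Fin k → ℕ) {a b : Fin k} (a≢b : a ≢ b)
         (o→o′ : ∀ i → + o′ i - + o i ≡ δ b i - δ a i) where

  occ-gain : o′ b ≡ suc (o b)
  occ-gain = trans (ℤP.+-injective (i-j≡k⇒i≡j+k (+ o′ b) (+ o b) shift-b)) (ℕP.+-comm (o b) 1)
    where shift-b : + o′ b - + o b ≡ + 1 - 0ℤ
          shift-b = trans (o→o′ b) (cong₂ _-_ (δ-refl b) (δ-≢ a≢b))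

  occ-loss : o a ≡ suc (o′ a)
  occ-loss = trans (ℤP.+-injective (i-j≡k⇒i≡j+k (+ o a) (+ o′ a) (i-j≡k⇒j-i≡-k (+ o′ a) (+ o a) shift-a)))
                   (ℕP.+-comm (o′ a) 1)
    where shift-a : + o′ a - + o a ≡ 0ℤ - + 1
          shift-a = trans (o→o′ a) (cong₂ _-_ (δ-≢ (a≢b ∘ sym)) (δ-refl a))

  occ-rest : ∀ {i} → i ≢ a → i ≢ b → o′ i ≡ o i
  occ-rest {i} i≢a i≢b = +m-+n≡0⇒m≡n (o′ i) (o i) shift-i
    where shift-i : + o′ i - + o i ≡ 0ℤ
          shift-i = trans (o→o′ i) (cong₂ _-_ (δ-≢ (i≢b ∘ sym)) (δ-≢ (i≢a ∘ sym)))

-- Makes the penalty closing b → a of a loop of A charge no more than B pays at b and a.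
ClosingFits : ∀ {n k} {A : Allotment n k} {a b} → Closing A a b → Allotment n k → Set
ClosingFits (viaTransfer _ _)             B = ⊤
ClosingFits {A = A} {a} {b} viaPenalty B = occ A b < occ B b × occ B a < occ A a

penalty-mono : ∀ {k} {c : Fin k → ℕ} {q : Fin k → ℕ → ℕ} → IsPenalty c q →
               ∀ i {m m′} → m ≤ m′ → q i m ≤ q i m′
penalty-mono {c = c} {q} isPenalty i {m} {m′} m≤m′ with m ℕ.≤? c i
... | yes m≤c = subst (_≤ q i m′) (sym (proj₁ (isPenalty i) m m≤c)) ℕ.z≤n
... | no  m≰c = proj₂ (proj₂ (isPenalty i)) m m′ (ℕP.≰⇒> m≰c) m≤m′

module Costs {n k : ℕ} (W : Fin n → Fin k → ℕ) (q : Fin k → ℕ → ℕ) where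

  unitCost : Fin n → Fin k → ℤ
  unitCost dn x = + W dn x

  closingCost : ∀ {X : Allotment n k} {a b} → Closing X a b → ℤ
  closingCost (viaTransfer _ _)            = 0ℤ
  closingCost {X} {a} {b} viaPenalty = + q b (suc (occ X b)) - + q a (occ X a)

  loopCost-split : ∀ X (L : Loop X) →
    loopCost X W q L ≡ sumℤ (map (moveChange X unitCost) (loopEdges X L)) + closingCost (closing L)
  loopCost-split X (mkLoop _ _ _ _ _ (viaTransfer _ _)) = sym (ℤP.+-identityʳ _)
  loopCost-split X (mkLoop _ _ _ _ _ viaPenalty)        = refl

  penalty : Fin k → ℕ → ℤ
  penalty i zero    = 0ℤ
  penalty i (suc o) = penalty i o + + q i (suc o)

  assignmentCost penaltyCost totalCost : Allotment n k → ℤ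
  assignmentCost X = ∑[ dn < n ] unitCost dn (X dn)
  penaltyCost    X = ∑[ i < k ] penalty i (occ X i)
  totalCost      X = assignmentCost X + penaltyCost X

  totalCost-diff : ∀ X Y →
    totalCost Y - totalCost X ≡ (assignmentCost Y - assignmentCost X) + (penaltyCost Y - penaltyCost X)
  totalCost-diff X Y = lemma (assignmentCost Y) (penaltyCost Y) (assignmentCost X) (penaltyCost X)
    where lemma : ∀ a b c d → (a + b) - (c + d) ≡ (a - c) + (b - d)
          lemma = solve-∀

  totalCost-cong : ∀ {X Y} → (∀ dn → X dn ≡ Y dn) → totalCost X ≡ totalCost Y
  totalCost-cong X≗Y = cong₂ _+_ (sum-cong-≗ (λ dn → cong (unitCost dn) (X≗Y dn)))
                                 (sum-cong-≗ (λ i → cong (penalty i) (occ-cong X≗Y i)))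

  penaltyCost-stay : ∀ X Y → (∀ i → + occ Y i - + occ X i ≡ 0ℤ) →
                     penaltyCost Y - penaltyCost X ≡ 0ℤ
  penaltyCost-stay X Y shift =
    trans (sym (∑-distrib-- (λ i → penalty i (occ Y i)) (λ i → penalty i (occ X i))))
          (sum-zero λ i → trans (cong (λ m → penalty i m - penalty i (occ X i))
                                      (+m-+n≡0⇒m≡n (occ Y i) (occ X i) (shift i)))
                                (ℤP.+-inverseʳ (penalty i (occ X i))))

  penaltyCost-move : ∀ X Y {a b} → a ≢ b → (∀ i → + occ Y i - + occ X i ≡ δ b i - δ a i) →
    penaltyCost Y - penaltyCost X ≡ + q b (occ Y b) - + q a (occ X a)
  penaltyCost-move X Y {a} {b} a≢b shift = begin
    penaltyCost Y - penaltyCost X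
      ≡⟨ ∑-distrib-- (λ i → penalty i (occ Y i)) (λ i → penalty i (occ X i)) ⟨
    sum h
      ≡⟨ sum-support (a ∷ b ∷ []) ((a≢b All.∷ All.[]) ∷ All.[] ∷ []) h h≡0 ⟩
    h a + (h b + 0ℤ)
      ≡⟨ cong₂ (λ u v → u + (v + 0ℤ)) h-a h-b ⟩
    - + q a (occ X a) + (+ q b (occ Y b) + 0ℤ)
      ≡⟨ reorder (+ q a (occ X a)) (+ q b (occ Y b)) ⟩
    + q b (occ Y b) - + q a (occ X a) ∎
    where
    open ≡-Reasoning
    h : Fin k → ℤ
    h i = penalty i (occ Y i) - penalty i (occ X i)
    h≡0 : ∀ i → i ∉ a ∷ b ∷ [] → h i ≡ 0ℤ
    h≡0 i i∉ = trans (cong (λ m → penalty i m - penalty i (occ X i))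
                           (occ-rest (occ X) (occ Y) a≢b shift (i∉ ∘ here) (i∉ ∘ there ∘ here)))
                     (ℤP.+-inverseʳ (penalty i (occ X i)))
    h-a : penalty a (occ Y a) - penalty a (occ X a) ≡ - + q a (occ X a)
    h-a rewrite occ-loss (occ X) (occ Y) a≢b shift = lose (penalty a (occ Y a)) (+ q a (suc (occ Y a)))
      where lose : ∀ x y → x - (x + y) ≡ - y
            lose = solve-∀
    h-b : penalty b (occ Y b) - penalty b (occ X b) ≡ + q b (occ Y b)
    h-b rewrite occ-gain (occ X) (occ Y) a≢b shift = gain (penalty b (occ X b)) (+ q b (suc (occ X b)))
      where gain : ∀ x y → (x + y) - x ≡ y
            gain = solve-∀
    reorder : ∀ x y → - x + (y + 0ℤ) ≡ y - x
    reorder = solve-∀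

  transfers-assignmentCost : ∀ {A : Allotment n k} {L : Loop A} {X Y} → Transfers L X Y →
    assignmentCost Y - assignmentCost X ≡ sumℤ (map (moveChange A unitCost) (loopEdges A L))
  transfers-assignmentCost {X = X} {Y} T =
    trans (sym (∑-distrib-- (λ dn → unitCost dn (Y dn)) (λ dn → unitCost dn (X dn))))
          (transfers-sum T unitCost)

  removeLoop-penaltyCost : ∀ X (L : Loop X) →
                           penaltyCost (removeLoop X L) - penaltyCost X ≡ closingCost (closing L)
  removeLoop-penaltyCost X L@(mkLoop _ _ _ _ _ (viaTransfer _ _)) =
    penaltyCost-stay X (removeLoop X L) (transfers-occ (removeLoop-transfers L))
  removeLoop-penaltyCost X L@(mkLoop a b a≢b _ _ viaPenalty) =
    trans (penaltyCost-move X (removeLoop X L) a≢b shift)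
          (cong (λ m → + q b m - + q a (occ X a)) (occ-gain (occ X) (occ (removeLoop X L)) a≢b shift))
    where shift = transfers-occ (removeLoop-transfers L)

  removeLoop-totalCost : ∀ X (L : Loop X) → totalCost (removeLoop X L) ≡ totalCost X + loopCost X W q L
  removeLoop-totalCost X L = i-j≡k⇒i≡j+k (totalCost (removeLoop X L)) (totalCost X) (begin
    totalCost (removeLoop X L) - totalCost X
      ≡⟨ totalCost-diff X (removeLoop X L) ⟩
    (assignmentCost (removeLoop X L) - assignmentCost X) + (penaltyCost (removeLoop X L) - penaltyCost X)
      ≡⟨ cong₂ _+_ (transfers-assignmentCost (removeLoop-transfers L)) (removeLoop-penaltyCost X L) ⟩
    sumℤ (map (moveChange X unitCost) (loopEdges X L)) + closingCost (closing L)
      ≡⟨ loopCost-split X L ⟨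
    loopCost X W q L ∎)
    where open ≡-Reasoning

  optimal-noNegLoop : ∀ X → (∀ B → totalCost X ℤ.≤ totalCost B) → NoNegLoop W q X
  optimal-noNegLoop X optimal L = i≤i+j⇒0≤j (totalCost X) (loopCost X W q L)
    (subst (totalCost X ℤ.≤_) (removeLoop-totalCost X L) (optimal (removeLoop X L)))

  removeLoop-noNegLoop : ∀ X (C : Loop X) → (∀ B → totalCost X + loopCost X W q C ℤ.≤ totalCost B) →
                         NoNegLoop W q (removeLoop X C)
  removeLoop-noNegLoop X C bound = optimal-noNegLoop (removeLoop X C) λ B →
    subst (ℤ._≤ totalCost B) (sym (removeLoop-totalCost X C)) (bound B)

  module _ (q-mono : ∀ i {m m′} → m ≤ m′ → q i m ≤ q i m′) {A : Allotment n k} where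

    transfers-closingCost : (L : Loop A) → ∀ {X Y} → Transfers L X Y → ClosingFits (closing L) Y →
      closingCost (closing L) ℤ.≤ penaltyCost Y - penaltyCost X
    transfers-closingCost (mkLoop _ _ _ _ _ (viaTransfer _ _)) {X} {Y} T _ =
      ℤP.≤-reflexive (sym (penaltyCost-stay X Y (transfers-occ T)))
    transfers-closingCost (mkLoop a b a≢b _ _ viaPenalty) {X} {Y} T (b-gains , a-loses) =
      subst (closingCost {A} viaPenalty ℤ.≤_) (sym (penaltyCost-move X Y a≢b shift))
        (ℤP.+-mono-≤ (ℤ.+≤+ (q-mono b b-gains)) (ℤP.neg-mono-≤ (ℤ.+≤+ (q-mono a X-a≤A-a))))
      where
      shift = transfers-occ T
      X-a≤A-a : occ X a ≤ occ A a
      X-a≤A-a = subst (_≤ occ A a) (sym (occ-loss (occ X) (occ Y) a≢b shift)) a-loses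

    transfers-totalCost : (L : Loop A) → ∀ {X Y} → Transfers L X Y → ClosingFits (closing L) Y →
      loopCost A W q L ℤ.≤ totalCost Y - totalCost X
    transfers-totalCost L {X} {Y} T fits = begin
      loopCost A W q L
        ≡⟨ loopCost-split A L ⟩
      sumℤ (map (moveChange A unitCost) (loopEdges A L)) + closingCost (closing L)
        ≤⟨ ℤP.+-monoʳ-≤ (sumℤ (map (moveChange A unitCost) (loopEdges A L))) (transfers-closingCost L T fits) ⟩
      sumℤ (map (moveChange A unitCost) (loopEdges A L)) + (penaltyCost Y - penaltyCost X)
        ≡⟨ cong (_+ (penaltyCost Y - penaltyCost X)) (transfers-assignmentCost T) ⟨
      (assignmentCost Y - assignmentCost X) + (penaltyCost Y - penaltyCost X)
        ≡⟨ totalCost-diff X Y ⟨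
      totalCost Y - totalCost X ∎
      where open ℤP.≤-Reasoning

loopCost-rowIndependent : ∀ {n k} {W W′ : Fin n → Fin k → ℕ} {q} {d} →
  (∀ dn → dn ≢ d → ∀ x → W′ dn x ≡ W dn x) → ∀ X (L : Loop X) → d ∉ movedUnits L →
  loopCost X W′ q L ≡ loopCost X W q L
loopCost-rowIndependent {W = W} {W′} {q} {d} sameRows X L d∉ = begin
  loopCost X W′ q L
    ≡⟨ C′.loopCost-split X L ⟩
  sumℤ (map (moveChange X C′.unitCost) (loopEdges X L)) + C′.closingCost (closing L)
    ≡⟨ cong (λ E → sumℤ E + C′.closingCost (closing L)) (map-cong-local (All.tabulate sameChange)) ⟩
  sumℤ (map (moveChange X C.unitCost) (loopEdges X L)) + C.closingCost (closing L)
    ≡⟨ C.loopCost-split X L ⟨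
  loopCost X W q L ∎
  where
  open ≡-Reasoning
  module C  = Costs W q
  module C′ = Costs W′ q
  sameChange : ∀ {e} → e ∈ loopEdges X L → moveChange X C′.unitCost e ≡ moveChange X C.unitCost e
  sameChange {dn , y} e∈ = cong₂ (λ u v → + u - + v) (sameRows dn dn≢d y) (sameRows dn dn≢d (X dn))
    where dn≢d : dn ≢ d
          dn≢d refl = d∉ (∈-map⁺ proj₁ e∈)

-- Decomposing the difference of two allotments into loops

module Decomposition {n k : ℕ} (A B : Allotment n k) where

  Agrees : List (Fin n × Fin k) → Set
  Agrees E = ∀ {e} → e ∈ E → B (proj₁ e) ≡ proj₂ e

  NoInflow : Fin k → Set
  NoInflow v = ∀ dn → B dn ≡ v → A dn ≡ v

  inflow? : ∀ v → (∃ λ dn → B dn ≡ v × A dn ≢ v) ⊎ NoInflow v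
  inflow? v with any? (λ dn → (B dn ≟ v) ×-dec ¬? (A dn ≟ v))
  ... | yes inflow = inj₁ inflow
  ... | no ∄inflow = inj₂ λ dn Bdn≡v →
    decidable-stable (A dn ≟ v) (λ Adn≢v → ∄inflow (dn , Bdn≡v , Adn≢v))

  δ-noInflow : ∀ {v} → NoInflow v → ∀ dn → δ (B dn) v ℤ.≤ δ (A dn) v
  δ-noInflow {v} noInflow dn with B dn ≟ v
  ... | yes Bdn≡v = ℤP.≤-reflexive (sym (trans (cong (λ x → δ x v) (noInflow dn Bdn≡v)) (δ-refl v)))
  ... | no  _     = δ-nonneg (A dn) v

  noInflow-occ-≤ : ∀ {v} → NoInflow v → occ B v ≤ occ A v
  noInflow-occ-≤ {v} noInflow = ℤP.drop‿+≤+ (subst₂ ℤ._≤_ (sym (occ-δ B v)) (sym (occ-δ A v))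
    (sum-mono-≤ (δ-noInflow noInflow)))

  noInflow-occ-< : ∀ {v} → NoInflow v → ∀ {dn} → A dn ≡ v → B dn ≢ v → occ B v < occ A v
  noInflow-occ-< {v} noInflow {dn} Adn≡v Bdn≢v = ℤP.drop‿+<+ (subst₂ ℤ._<_ (sym (occ-δ B v)) (sym (occ-δ A v))
    (sum-mono-< (δ-noInflow noInflow) dn δ-strict))
    where δ-strict : δ (B dn) v ℤ.< δ (A dn) v
          δ-strict = subst₂ ℤ._<_ (sym (δ-≢ Bdn≢v)) (sym (trans (cong (λ x → δ x v) Adn≡v) (δ-refl v)))
                            (ℤ.+<+ (ℕ.s≤s ℕ.z≤n))

  record LoopIn : Set where
    field
      loop   : Loop A
      agrees : Agrees (loopEdges A loop)
      fits   : ClosingFits (closing loop) B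

  record DeadEnd (b : Fin k) : Set where
    field
      {start}  : Fin k
      trail    : Path A start b
      simple   : Unique (vertices A trail)
      agrees   : Agrees (pathEdges A trail)
      noInflow : NoInflow start

  -- The vertices of p stay distinct, so fuel k suffices.
  traceBack : ∀ (fuel : ℕ) {v b} (p : Path A v b) → Unique (vertices A p) → Agrees (pathEdges A p) →
              k < length (vertices A p) ℕ.+ fuel → LoopIn ⊎ DeadEnd b
  traceBack zero p !p _ k< =
    ⊥-elim (ℕP.<⇒≱ (subst (k <_) (ℕP.+-identityʳ _) k<) (Unique-length≤ !p))
  traceBack (suc fuel) {v} p !p agrees k< with inflow? v
  ... | inj₂ noInflow = inj₂ (record { trail = p ; simple = !p ; agrees = agrees ; noInflow = noInflow })
  ... | inj₁ (dn , Bdn≡v , Adn≢v) with Any.any? (A dn ≟_) (vertices A p)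
  ...   | no Adn∉p = traceBack fuel (cons dn v refl p) (¬Any⇒All¬ _ Adn∉p ∷ !p) agrees′
                               (subst (k <_) (ℕP.+-suc _ fuel) k<)
    where agrees′ : Agrees ((dn , v) ∷ pathEdges A p)
          agrees′ (here refl) = Bdn≡v
          agrees′ (there e∈)  = agrees e∈
  ...   | yes Adn∈p with prefix p !p Adn∈p Adn≢v
  ...     | q , !q , _ , E⊆ = inj₁ (record
              { loop = mkLoop v (A dn) (Adn≢v ∘ sym) q !q (viaTransfer dn refl) ; agrees = agrees′ ; fits = tt })
    where agrees′ : Agrees (pathEdges A q ++ (dn , v) ∷ [])
          agrees′ e∈ with ∈-++⁻ (pathEdges A q) e∈
          ... | inj₁ e∈q         = agrees (E⊆ e∈q)
          ... | inj₂ (here refl) = Bdn≡v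

  deadEnd-start : ∀ {b} (end : DeadEnd b) → let v = DeadEnd.start end in v ≢ b × occ B v < occ A v
  deadEnd-start end with firstEdge (DeadEnd.trail end)
  ... | e , e∈ , Ae≡v = (λ v≡b → source≢last trail simple e∈ (trans Ae≡v v≡b))
                      , noInflow-occ-< noInflow Ae≡v Be≢v
    where
    open DeadEnd end
    Be≢v : B (proj₁ e) ≢ start
    Be≢v Be≡v = target≢source trail simple e∈ (trans (sym (agrees e∈)) (trans Be≡v (sym Ae≡v)))

  traceBackFrom : ∀ {dn} → A dn ≢ B dn → LoopIn ⊎ DeadEnd (B dn)
  traceBackFrom {dn} Adn≢Bdn =
    traceBack k (step dn (B dn) refl) ((Adn≢Bdn All.∷ All.[]) ∷ All.[] ∷ [])
              (λ { (here refl) → refl }) (ℕP.m<n+m k (ℕ.s≤s ℕ.z≤n))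

  loopIn : ∀ {x} → A x ≢ B x → LoopIn
  loopIn {x} Ax≢Bx with any? (λ b → occ A b ℕ.<? occ B b)
  ... | yes (b , b-gains) with inflow? b
  ...   | inj₂ noInflow = ⊥-elim (ℕP.<⇒≱ b-gains (noInflow-occ-≤ noInflow))
  ...   | inj₁ (dn , Bdn≡b , Adn≢b) with traceBackFrom (Adn≢b ∘ flip trans Bdn≡b)
  ...     | inj₁ found = found
  ...     | inj₂ end   = record
              { loop = mkLoop start (B dn) start≢b trail simple viaPenalty ; agrees = agrees
              ; fits = subst (λ c → occ A c < occ B c) (sym Bdn≡b) b-gains , start-loses }
    where open DeadEnd end
          start≢b = proj₁ (deadEnd-start end)
          start-loses = proj₂ (deadEnd-start end)
  loopIn {x} Ax≢Bx | no ∄gain with traceBackFrom Ax≢Bx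
  ... | inj₁ found = found
  ... | inj₂ end   = ⊥-elim (ℤP.<-irrefl (trans (sum-occ B) (sym (sum-occ A))) total-loses)
    where
    total-loses : ∑[ i < k ] (+ occ B i) ℤ.< ∑[ i < k ] (+ occ A i)
    total-loses = sum-mono-< (λ i → ℤ.+≤+ (ℕP.≮⇒≥ (λ gain → ∄gain (i , gain))))
                             (DeadEnd.start end) (ℤ.+<+ (proj₂ (deadEnd-start end)))

-- Optimality

module Optimality {n k : ℕ} (W : Fin n → Fin k → ℕ) (q : Fin k → ℕ → ℕ)
  (q-mono : ∀ i {m m′} → m ≤ m′ → q i m ≤ q i m′)
  (A : Allotment n k) (d : Fin n) (m : ℤ) (m≤0 : m ℤ.≤ 0ℤ)
  (bound   : ∀ L → m ℤ.≤ loopCost A W q L)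
  (bound-d : ∀ L → d ∉ movedUnits L → 0ℤ ℤ.≤ loopCost A W q L) where

  open Costs W q
  open Decomposition A

  CostBound : Allotment n k → Set
  CostBound B = totalCost A + m ℤ.≤ totalCost B × (A d ≡ B d → totalCost A ℤ.≤ totalCost B)

  undo : Loop A → Allotment n k → Allotment n k
  undo C B x = if does (Any.any? (x ≟_) (movedUnits C)) then A x else B x

  undo-moved : ∀ C B {x} → x ∈ movedUnits C → undo C B x ≡ A x
  undo-moved C B {x} x∈ = cong (if_then A x else B x) (dec-true (Any.any? (x ≟_) (movedUnits C)) x∈)

  undo-unmoved : ∀ C B {x} → x ∉ movedUnits C → undo C B x ≡ B x
  undo-unmoved C B {x} x∉ = cong (if_then A x else B x) (dec-false (Any.any? (x ≟_) (movedUnits C)) x∉)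

  undo-transfers : ∀ {B} (C : Loop A) → Agrees B (loopEdges A C) → Transfers C (undo C B) B
  undo-transfers {B} C agrees = record
    { moved   = agrees
    ; source  = λ e∈ → undo-moved C B (∈-map⁺ proj₁ e∈)
    ; unmoved = λ dn dn∉ → sym (undo-unmoved C B dn∉) }

  disagreement : Allotment n k → ℤ
  disagreement B = ∑[ x < n ] mismatch (A x) (B x)

  undo-disagreement : ∀ {B} (C : Loop A) → Agrees B (loopEdges A C) →
                      disagreement (undo C B) ℤ.< disagreement B
  undo-disagreement {B} C agrees =
    sum-mono-< ≤-pointwise u (subst₂ ℤ._<_ (sym undone) (sym (mismatch-≢ A≢B)) (ℤ.+<+ (ℕ.s≤s ℕ.z≤n)))
    where
    ≤-pointwise : ∀ x → mismatch (A x) (undo C B x) ℤ.≤ mismatch (A x) (B x)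
    ≤-pointwise x = [ (λ x∈ → subst (ℤ._≤ mismatch (A x) (B x)) (sym (mismatch-≡ (sym (undo-moved C B x∈))))
                                    (mismatch-nonneg (A x) (B x)))
                    , (λ x∉ → ℤP.≤-reflexive (cong (mismatch (A x)) (undo-unmoved C B x∉)))
                    ]′ (toSum (Any.any? (x ≟_) (movedUnits C)))
    e = proj₁ (loop-firstEdge C)
    e∈ = proj₂ (loop-firstEdge C)
    u = proj₁ e
    undone : mismatch (A u) (undo C B u) ≡ 0ℤ
    undone = mismatch-≡ (sym (undo-moved C B (∈-map⁺ proj₁ e∈)))
    A≢B : A u ≢ B u
    A≢B eq = loop-target≢source C e∈ (trans (sym (agrees e∈)) (sym eq))

  agreeing-costBound : ∀ {B} → (∀ x → A x ≡ B x) → CostBound B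
  agreeing-costBound A≗B = subst (totalCost A + m ℤ.≤_) same A+m≤A , λ _ → ℤP.≤-reflexive same
    where
    same = totalCost-cong A≗B
    A+m≤A = ℤP.≤-trans (ℤP.+-monoʳ-≤ (totalCost A) m≤0) (ℤP.≤-reflexive (ℤP.+-identityʳ (totalCost A)))

  disagreement-pos : ∀ {B x} → A x ≢ B x → 0ℤ ℤ.< disagreement B
  disagreement-pos {B} {x} Ax≢Bx =
    subst (ℤ._< disagreement B) (sum-replicate-zero n)
      (sum-mono-< (λ y → mismatch-nonneg (A y) (B y)) x
                  (subst (0ℤ ℤ.<_) (sym (mismatch-≢ Ax≢Bx)) (ℤ.+<+ (ℕ.s≤s ℕ.z≤n))))

  extend-costBound : ∀ {B} (C : Loop A) → Agrees B (loopEdges A C) → ClosingFits (closing C) B →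
                     CostBound (undo C B) → CostBound B
  extend-costBound {B} C agrees fits (bound₁ , bound₂) =
    [ moving-d , fixing-d ]′ (toSum (Any.any? (d ≟_) (movedUnits C)))
    where
    via-C : totalCost (undo C B) + loopCost A W q C ℤ.≤ totalCost B
    via-C = i+j≤k⇐j≤k-i (totalCost (undo C B)) (loopCost A W q C) (totalCost B)
                        (transfers-totalCost q-mono C (undo-transfers C agrees) fits)

    moving-d : d ∈ movedUnits C → CostBound B
    moving-d d∈ = ℤP.≤-trans (ℤP.+-mono-≤ (bound₂ (sym (undo-moved C B d∈))) (bound C)) via-C
                , λ Ad≡Bd → ⊥-elim (d-moves Ad≡Bd)
      where
      d-moves : A d ≢ B d
      d-moves Ad≡Bd with ∈-map⁻ proj₁ d∈
      ... | _ , e∈ , refl = loop-target≢source C e∈ (trans (sym (agrees e∈)) (sym Ad≡Bd))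

    fixing-d : d ∉ movedUnits C → CostBound B
    fixing-d d∉ = ℤP.≤-trans bound₁ undo≤B
                , λ Ad≡Bd → ℤP.≤-trans (bound₂ (trans Ad≡Bd (sym (undo-unmoved C B d∉)))) undo≤B
      where
      undo≤B : totalCost (undo C B) ℤ.≤ totalCost B
      undo≤B = begin
        totalCost (undo C B)                      ≡⟨ ℤP.+-identityʳ (totalCost (undo C B)) ⟨
        totalCost (undo C B) + 0ℤ                 ≤⟨ ℤP.+-monoʳ-≤ (totalCost (undo C B)) (bound-d C d∉) ⟩
        totalCost (undo C B) + loopCost A W q C   ≤⟨ via-C ⟩
        totalCost B                               ∎
        where open ℤP.≤-Reasoning

  costBound-within : ∀ N B → disagreement B ℤ.≤ + N → CostBound B
  costBound-within N B D≤N with any? (λ x → ¬? (A x ≟ B x))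
  ... | no ∄diff = agreeing-costBound λ x →
    decidable-stable (A x ≟ B x) (λ Ax≢Bx → ∄diff (x , Ax≢Bx))
  ... | yes (x , Ax≢Bx) with N
  ...   | zero  = ⊥-elim (ℤP.<-irrefl refl (ℤP.<-≤-trans (disagreement-pos Ax≢Bx) D≤N))
  ...   | suc N = extend-costBound loop agrees fits
      (costBound-within N (undo loop B)
        (ℤP.i<j⇒i≤pred[j] (ℤP.<-≤-trans (undo-disagreement loop agrees) D≤N)))
    where open LoopIn B (loopIn B Ax≢Bx)

  costBound : ∀ B → CostBound B
  costBound B = costBound-within ℤ.∣ disagreement B ∣ B (ℤP.≤-reflexive (sym (ℤP.0≤i⇒+∣i∣≡i 0≤D)))
    where 0≤D = subst (ℤ._≤ disagreement B) (sum-replicate-zero n)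
                      (sum-mono-≤ (λ x → mismatch-nonneg (A x) (B x)))

replaceRow-other : ∀ {n k} (W : Fin n → Fin k → ℕ) {d} (new : Fin k → ℕ) →
                   ∀ dn → dn ≢ d → ∀ x → replaceRow W d new dn x ≡ W dn x
replaceRow-other W {d} new dn dn≢d x = cong (if_then new x else W dn x) (dec-false (dn ≟ d) dn≢d)

noNegLoop-replaceRow : ∀ {n k} {W : Fin n → Fin k → ℕ} {q} → (∀ i {m m′} → m ≤ m′ → q i m ≤ q i m′) →
  ∀ {X X′ : Allotment n k} → NoNegLoop W q X → (∀ dn → X′ dn ≡ X dn) →
  ∀ d new (L : Loop X′) → d ∉ movedUnits L → 0ℤ ℤ.≤ loopCost X′ (replaceRow W d new) q L
noNegLoop-replaceRow {W = W} {q} q-mono {X} {X′} noNeg X′≗X d new L d∉ =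
  subst (0ℤ ℤ.≤_) (sym (loopCost-rowIndependent (replaceRow-other W new) X′ L d∉))
        (optimal-noNegLoop X′ X′-optimal L)
  where
  open Costs W q
  X′-optimal : ∀ B → totalCost X′ ℤ.≤ totalCost B
  X′-optimal B = subst₂ ℤ._≤_ (trans (ℤP.+-identityʳ _) (totalCost-cong (sym ∘ X′≗X))) refl
    (proj₁ (Optimality.costBound W q q-mono X d 0ℤ ℤP.≤-refl noNeg (λ L _ → noNeg L) B))

lemma1 : ∀ {n k : ℕ} → 2 ≤ k
  → (CM : Fin n → Fin k → ℕ) → (∀ d x → 0 < CM d x)
  → (c : Fin k → ℕ) → (∀ i → 0 < c i)
  → (q : Fin k → ℕ → ℕ) → IsPenalty c q
  → (A1 : Allotment n k) → NoNegLoop CM q A1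
  → (j : Fin k) (d : Fin n) → A1 d ≡ j
  → (new : Fin k → ℕ) → (∀ x → 0 < new x)
  → (A2 : Allotment n k) → (∀ d′ → d′ ≢ d → A2 d′ ≡ A1 d′) → A2 d ≡ j
  → (Cmin : Loop A2) → passesThrough A2 j Cmin
  → (∀ (L : Loop A2) → passesThrough A2 j L
       → loopCost A2 (replaceRow CM d new) q Cmin ℤ.≤ loopCost A2 (replaceRow CM d new) q L)
  → ((0ℤ ℤ.≤ loopCost A2 (replaceRow CM d new) q Cmin
        → NoNegLoop (replaceRow CM d new) q A2)
     × (loopCost A2 (replaceRow CM d new) q Cmin ℤ.< 0ℤ
        → NoNegLoop (replaceRow CM d new) q (removeLoop A2 Cmin)))
lemma1 _ CM _ c _ q isPenalty A1 noNeg₁ j d A1d≡j new _ A2 A2≡A1 A2d≡j Cmin _ minimal = partA , partB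
  where
  W′ = replaceRow CM d new
  m  = loopCost A2 W′ q Cmin

  A2≗A1 : ∀ dn → A2 dn ≡ A1 dn
  A2≗A1 dn with dn ≟ d
  ... | yes refl = trans A2d≡j (sym A1d≡j)
  ... | no dn≢d  = A2≡A1 dn dn≢d

  fixing-d-nonneg : ∀ L → d ∉ movedUnits L → 0ℤ ℤ.≤ loopCost A2 W′ q L
  fixing-d-nonneg = noNegLoop-replaceRow (penalty-mono isPenalty) noNeg₁ A2≗A1 d new

  through-j-or-fixing-d : ∀ L → passesThrough A2 j L ⊎ d ∉ movedUnits L
  through-j-or-fixing-d L =
    map₁ (subst (λ v → passesThrough A2 v L) A2d≡j) (passesThrough-or-unmoved L d)

  partA : 0ℤ ℤ.≤ m → NoNegLoop W′ q A2
  partA 0≤m L = [ ℤP.≤-trans 0≤m ∘ minimal L , fixing-d-nonneg L ]′ (through-j-or-fixing-d L)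

  partB : m ℤ.< 0ℤ → NoNegLoop W′ q (removeLoop A2 Cmin)
  partB m<0 = Costs.removeLoop-noNegLoop W′ q A2 Cmin
    (proj₁ ∘ Optimality.costBound W′ q (penalty-mono isPenalty) A2 d m (ℤP.<⇒≤ m<0) m≤ fixing-d-nonneg)
    where m≤ : ∀ L → m ℤ.≤ loopCost A2 W′ q L
          m≤ L = [ minimal L , ℤP.≤-trans (ℤP.<⇒≤ m<0) ∘ fixing-d-nonneg L ]′ (through-j-or-fixing-d L)
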